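{- Consider a normalized instance of \textsc{Constrained Layer Tree}. Let $c\in\mathbb N^{\lambda+1}$ be a relaxed partial solution with $c_0>2$ leaves and branching layer $k$. Then there exist relaxed partial solutions $a,b\in\mathbb N^{\lambda+1}$ with $a_0<c_0$ and $b_0<c_0$ leaves such that $a_0\ge\ell_k$, $b_0\ge\ell_k$, and $c$ is the $k$-combination of $a$ and $b$.
   Context: A layer tree with layers $0,\dots,\lambda$ is a rooted tree whose leaves are in layer $0$, with exactly one root in layer $\lambda$, every edge going from a vertex in layer $i-1$ to its parent in layer $i$. The weight $w(v)$ of a vertex is the number of leaves in its subtree. An instance of \textsc{Constrained Layer Tree} is given by nonnegative integers $n_0$ and $(n_i,\ell_i,u_i)_{i\in\{1,\dots,\lambda\}}$, with the convention $\ell_0=u_0=1$. The instance is normalized if $n_i\le n_{i-1}$, $\ell_i\ge\ell_{i-1}$, $u_i\ge u_{i-1}$ for all $i\in\{1,\dots,\lambda\}$. The branching layer of a layer tree (or of a vector $a\in\mathbb N^{\lambda+1}$) is the highest layer $i$ with more than one vertex (resp. $a_i>1$), and $0$ if no such layer exists. A layer tree with branching layer $k$ is almost valid if it has at most $n_i$ vertices in each layer $i$, every vertex $v$ in a layer $i\in\{1,\dots,k\}$ satisfies $\ell_i\le w(v)\le u_i$, and the number of leaves is at most $u_i$ for each $i\in\{k+1,\dots,\lambda\}$. A vector $a=(a_0,\dots,a_\lambda)$ is a relaxed partial solution (with $a_0$ leaves) if there is an almost valid layer tree with exactly $a_i$ vertices in layer $i$ for each $i$. For such vectors $a,b$ with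 branching layers $k_a,k_b$ and $k\in\{\max\{k_a,k_b\},\dots,\lambda\}$, the $k$-combination of $a$ and $b$ is $(a_0+b_0,\dots,a_k+b_k,1,\dots,1)$. -}

module Defs where

open import Data.Nat using (ℕ; zero; suc; _+_; _≤_; _<_; _<?_; _≤?_)
open import Data.Fin using (Fin; zero; suc; toℕ; fromℕ; inject₁)
open import Data.List using (List; []; _∷_; [_]; _++_; length)
open import Data.List.Relation.Unary.All using (All)
open import Data.Product using (Σ; _×_; _,_)
open import Data.Bool using (if_then_else_)
open import Relation.Nullary using (does)
open import Relation.Binary.PropositionalEquality using (_≡_)
open import Data.Nat using (_≟_)

-- A vertex in layer 0 is a leaf;
-- a vertex in layer (suc i) has a nonempty list of children in layer i
-- (all leaves lie in layer 0, every edge goes from layer i-1 to layer i).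
data LTree : ℕ → Set where
  leaf : LTree zero
  node : ∀ {i} → LTree i → List (LTree i) → LTree (suc i)

mutual
  leaves : ∀ {h} → LTree h → ℕ
  leaves leaf        = 1
  leaves (node c cs) = leaves c + leavesL cs

  leavesL : ∀ {h} → List (LTree h) → ℕ
  leavesL []       = 0
  leavesL (t ∷ ts) = leaves t + leavesL ts

mutual
  weightsAt : ∀ {h} → ℕ → LTree h → List ℕ
  weightsAt j leaf = if does (j ≟ 0) then [ 1 ] else []
  weightsAt {suc i} j (node c cs) =
    if does (j ≟ suc i) then [ leaves (node c cs) ] else weightsAtL j (c ∷ cs)

  weightsAtL : ∀ {h} → ℕ → List (LTree h) → List ℕ
  weightsAtL j []       = []
  weightsAtL j (t ∷ ts) = weightsAt j t ++ weightsAtL j ts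

count : ∀ {h} → Fin (suc h) → LTree h → ℕ
count i t = length (weightsAt (toℕ i) t)

branchLayer : ∀ {m} → (Fin (suc m) → ℕ) → Fin (suc m)
branchLayer {zero}  a = zero
branchLayer {suc m} a =
  if does (1 <? a (fromℕ (suc m))) then fromℕ (suc m)
  else inject₁ (branchLayer {m} (λ i → a (inject₁ i)))

record Instance : Set where
  field
    lam : ℕ
    n   : Fin (suc lam) → ℕ
    ℓ   : Fin lam → ℕ
    u   : Fin lam → ℕ

  -- lower / upper bounds with the convention ℓ_0 = u_0 = 1
  L : Fin (suc lam) → ℕ
  L zero    = 1
  L (suc i) = ℓ i

  U : Fin (suc lam) → ℕ
  U zero    = 1
  U (suc i) = u i

open Instance public

Normalized : Instance → Set
Normalized I = ∀ (i : Fin (lam I)) →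
  (n I (suc i) ≤ n I (inject₁ i)) × (L I (inject₁ i) ≤ L I (suc i)) × (U I (inject₁ i) ≤ U I (suc i))

treeBranch : ∀ {h} → LTree h → Fin (suc h)
treeBranch t = branchLayer (λ i → count i t)

AlmostValid : (I : Instance) → LTree (lam I) → Set
AlmostValid I t =
  (∀ i → count i t ≤ n I i) ×
  (∀ i → 1 ≤ toℕ i → toℕ i ≤ toℕ (treeBranch t) →
     All (λ w → L I i ≤ w × w ≤ U I i) (weightsAt (toℕ i) t)) ×
  (∀ i → toℕ (treeBranch t) < toℕ i → leaves t ≤ U I i)

RelaxedPartialSolution : (I : Instance) → (Fin (suc (lam I)) → ℕ) → Set
RelaxedPartialSolution I a =
  Σ (LTree (lam I)) λ t → AlmostValid I t × (∀ i → count i t ≡ a i)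

combination : ∀ {m} → Fin (suc m) → (Fin (suc m) → ℕ) → (Fin (suc m) → ℕ) → Fin (suc m) → ℕ
combination k a b i = if does (toℕ i ≤? toℕ k) then a i + b i else 1

IsCombination : ∀ {m} → Fin (suc m) → (a b c : Fin (suc m) → ℕ) → Set
IsCombination k a b c =
  (toℕ (branchLayer a) ≤ toℕ k) × (toℕ (branchLayer b) ≤ toℕ k) ×
  (∀ i → c i ≡ combination k a b i)

{-# OPTIONS --safe #-}

-- Follow the tree realising c down from the root through single-child vertices to the
-- first vertex v with at least two children; its children lie in the branching layer k.
-- Keeping the path from the root to v but giving v only its first child, respectively
-- only its other children, yields two trees A and B.  Up to layer k every layer of A and
-- of B is a sublist of the corresponding layer of the original tree, so vertex counts
-- and weight bounds are inherited; above k both are paths, whose weights are their leaf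
-- numbers and so at most that of the original tree.  Hence the layer counts of A and B
-- are relaxed partial solutions with k-combination c, and each has at least ℓ_k leaves
-- because its layer k is nonempty with weights at least ℓ_k.

module Submission where

open import Defs
open import Data.Nat using (ℕ; suc; _+_; _≤_; _<_; z≤n; s≤s; _≟_; _≤?_; _<?_)
open import Data.Nat.Properties
open import Data.Fin using (Fin; zero; toℕ; fromℕ; fromℕ<; inject₁) renaming (suc to fsuc)
open import Data.Fin.Properties using (toℕ≤pred[n]; toℕ-fromℕ; toℕ-fromℕ<; toℕ-inject₁)
open import Data.Fin.Relation.Unary.Top using (view; ‵fromℕ; ‵inject₁)
open import Data.List using (List; []; _∷_; [_]; _++_; length)
open import Data.List.Properties using (length-++; ++-identityʳ)
open import Data.List.Relation.Unary.All as All using (All)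
open import Data.List.Relation.Binary.Sublist.Propositional using (_⊆_; ⊆-refl)
open import Data.List.Relation.Binary.Sublist.Propositional.Properties
  using (All-resp-⊆; length-mono-≤; ++⁺ʳ; ++⁺ˡ)
open import Data.Nat.ListAction using (sum)
open import Data.Nat.ListAction.Properties using (sum-++)
open import Data.Product using (Σ; _×_; _,_; proj₁; proj₂)
open import Data.Sum using (_⊎_; inj₁; inj₂)
open import Function using (_∘_)
open import Relation.Nullary using (yes; no; ¬_; contradiction)
open import Relation.Nullary.Decidable using (dec-true; dec-false)
open import Relation.Binary.PropositionalEquality hiding ([_])
open ≡-Reasoning

weightsAt-top : ∀ {i} (c : LTree i) cs → weightsAt (suc i) (node c cs) ≡ [ leaves (node c cs) ]
weightsAt-top {i} c cs rewrite dec-true (suc i ≟ suc i) refl = refl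

weightsAt-below : ∀ {i j} (c : LTree i) cs → j ≤ i → weightsAt j (node c cs) ≡ weightsAtL j (c ∷ cs)
weightsAt-below {i} {j} c cs j≤i rewrite dec-false (j ≟ suc i) (λ { refl → 1+n≰n j≤i }) = refl

weightsAt-node-[] : ∀ {i j} (c : LTree i) → j ≤ i → weightsAt j (node c []) ≡ weightsAt j c
weightsAt-node-[] {j = j} c j≤i = trans (weightsAt-below c [] j≤i) (++-identityʳ (weightsAt j c))

weightsAt-nonempty : ∀ {h j} (t : LTree h) → j ≤ h → 1 ≤ length (weightsAt j t)
weightsAt-nonempty leaf z≤n = s≤s z≤n
weightsAt-nonempty {j = j} (node c cs) j≤h with m≤n⇒m<n∨m≡n j≤h
... | inj₂ refl rewrite weightsAt-top c cs = s≤s z≤n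
... | inj₁ (s≤s j≤i) rewrite weightsAt-below c cs j≤i | length-++ (weightsAt j c) {weightsAtL j cs} =
  ≤-trans (weightsAt-nonempty c j≤i) (m≤m+n _ _)

mutual
  sum-weightsAt : ∀ {h j} (t : LTree h) → j ≤ h → sum (weightsAt j t) ≡ leaves t
  sum-weightsAt leaf z≤n = refl
  sum-weightsAt {j = j} (node c cs) j≤h with m≤n⇒m<n∨m≡n j≤h
  ... | inj₂ refl rewrite weightsAt-top c cs = +-identityʳ _
  ... | inj₁ (s≤s j≤i) rewrite weightsAt-below c cs j≤i = sum-weightsAtL (c ∷ cs) j≤i

  sum-weightsAtL : ∀ {h j} (ts : List (LTree h)) → j ≤ h → sum (weightsAtL j ts) ≡ leavesL ts
  sum-weightsAtL []       _   = refl
  sum-weightsAtL {j = j} (t ∷ ts) j≤h = begin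
    sum (weightsAt j t ++ weightsAtL j ts)
      ≡⟨ sum-++ (weightsAt j t) (weightsAtL j ts) ⟩
    sum (weightsAt j t) + sum (weightsAtL j ts)
      ≡⟨ cong₂ _+_ (sum-weightsAt t j≤h) (sum-weightsAtL ts j≤h) ⟩
    leaves t + leavesL ts
      ∎

mutual
  length-weightsAt-zero : ∀ {h} (t : LTree h) → length (weightsAt 0 t) ≡ leaves t
  length-weightsAt-zero leaf        = refl
  length-weightsAt-zero (node c cs) = length-weightsAtL-zero (c ∷ cs)

  length-weightsAtL-zero : ∀ {h} (ts : List (LTree h)) → length (weightsAtL 0 ts) ≡ leavesL ts
  length-weightsAtL-zero []       = refl
  length-weightsAtL-zero (t ∷ ts) = begin
    length (weightsAt 0 t ++ weightsAtL 0 ts)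
      ≡⟨ length-++ (weightsAt 0 t) ⟩
    length (weightsAt 0 t) + length (weightsAtL 0 ts)
      ≡⟨ cong₂ _+_ (length-weightsAt-zero t) (length-weightsAtL-zero ts) ⟩
    leaves t + leavesL ts
      ∎

weightsAt-single : ∀ {h j} (t : LTree h) → j ≤ h →
                   length (weightsAt j t) ≡ 1 → weightsAt j t ≡ [ leaves t ]
weightsAt-single {j = j} t j≤h one with weightsAt j t | sum-weightsAt t j≤h
weightsAt-single t j≤h refl | w ∷ [] | w+0≡leaves = cong [_] (trans (sym (+-identityʳ w)) w+0≡leaves)

≤-leaves : ∀ {h j y} (t : LTree h) → j ≤ h → All (y ≤_) (weightsAt j t) → y ≤ leaves t
≤-leaves {j = j} t j≤h y≤ws with weightsAt j t | sum-weightsAt t j≤h | weightsAt-nonempty t j≤h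
≤-leaves t j≤h (y≤w All.∷ _) | w ∷ ws | sum≡leaves | _ =
  ≤-trans y≤w (subst (w ≤_) sum≡leaves (m≤m+n w (sum ws)))

PathAbove : ∀ {h} → ℕ → LTree h → Set
PathAbove {h} s t = ∀ {j} → s < j → j ≤ h → length (weightsAt j t) ≡ 1

pathAbove-top : ∀ {i} (c : LTree i) cs → PathAbove i (node c cs)
pathAbove-top c cs i<j j≤1+i rewrite ≤-antisym j≤1+i i<j | weightsAt-top c cs = refl

pathAbove-node-[] : ∀ {i s} (c : LTree i) → PathAbove s c → PathAbove s (node c [])
pathAbove-node-[] c path s<j j≤1+i with m≤n⇒m<n∨m≡n j≤1+i
... | inj₂ refl = cong length (weightsAt-top c [])
... | inj₁ (s≤s j≤i) = trans (cong length (weightsAt-node-[] c j≤i)) (path s<j j≤i)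

data Fork : ∀ {h} → LTree h → Set where
  fork  : ∀ {i} (c d : LTree i) ds → Fork (node c (d ∷ ds))
  below : ∀ {i} {t : LTree i} → Fork t → Fork (node t [])

fork? : ∀ {h} (t : LTree h) → Fork t ⊎ leaves t ≡ 1
fork? leaf               = inj₂ refl
fork? (node c (d ∷ ds))  = inj₁ (fork c d ds)
fork? (node c [])        with fork? c
... | inj₁ f             = inj₁ (below f)
... | inj₂ one           = inj₂ (trans (+-identityʳ (leaves c)) one)

forkLayer : ∀ {h} {t : LTree h} → Fork t → ℕ
forkLayer (fork {i} _ _ _) = i
forkLayer (below f)        = forkLayer f

left right : ∀ {h} {t : LTree h} → Fork t → LTree h
left  (fork c _ _)  = node c []
left  (below f)     = node (left f) []
right (fork _ d ds) = node d ds
right (below f)     = node (right f) []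

forkLayer< : ∀ {h} {t : LTree h} (f : Fork t) → forkLayer f < h
forkLayer< (fork _ _ _) = ≤-refl
forkLayer< (below f)    = m<n⇒m<1+n (forkLayer< f)

weightsAt-fork : ∀ {h j} {t : LTree h} (f : Fork t) → j ≤ forkLayer f →
                 weightsAt j t ≡ weightsAt j (left f) ++ weightsAt j (right f)
weightsAt-fork {j = j} (fork c d ds) j≤i = begin
  weightsAt j (node c (d ∷ ds))
    ≡⟨ weightsAt-below c (d ∷ ds) j≤i ⟩
  weightsAt j c ++ weightsAtL j (d ∷ ds)
    ≡⟨ cong₂ _++_ (weightsAt-node-[] c j≤i) (weightsAt-below d ds j≤i) ⟨
  weightsAt j (node c []) ++ weightsAt j (node d ds)
    ∎
weightsAt-fork {j = j} (below {t = t} f) j≤s = begin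
  weightsAt j (node t [])
    ≡⟨ weightsAt-node-[] t j≤i ⟩
  weightsAt j t
    ≡⟨ weightsAt-fork f j≤s ⟩
  weightsAt j (left f) ++ weightsAt j (right f)
    ≡⟨ cong₂ _++_ (weightsAt-node-[] (left f) j≤i) (weightsAt-node-[] (right f) j≤i) ⟨
  weightsAt j (node (left f) []) ++ weightsAt j (node (right f) [])
    ∎
  where j≤i = <⇒≤ (≤-<-trans j≤s (forkLayer< f))

pathAbove-fork : ∀ {h} {t : LTree h} (f : Fork t) → PathAbove (forkLayer f) t
pathAbove-fork (fork c d ds)      = pathAbove-top c (d ∷ ds)
pathAbove-fork (below {t = t} f)  = pathAbove-node-[] t (pathAbove-fork f)

pathAbove-left : ∀ {h} {t : LTree h} (f : Fork t) → PathAbove (forkLayer f) (left f)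
pathAbove-left (fork c _ _) = pathAbove-top c []
pathAbove-left (below f)    = pathAbove-node-[] (left f) (pathAbove-left f)

pathAbove-right : ∀ {h} {t : LTree h} (f : Fork t) → PathAbove (forkLayer f) (right f)
pathAbove-right (fork _ d ds) = pathAbove-top d ds
pathAbove-right (below f)     = pathAbove-node-[] (right f) (pathAbove-right f)

module _ {m} (a : Fin (suc (suc m)) → ℕ) where

  branchLayer-last : 1 < a (fromℕ (suc m)) → branchLayer a ≡ fromℕ (suc m)
  branchLayer-last 1<aₘ rewrite dec-true (1 <? a (fromℕ (suc m))) 1<aₘ = refl

  branchLayer-inject₁ : ¬ 1 < a (fromℕ (suc m)) → branchLayer a ≡ inject₁ (branchLayer (a ∘ inject₁))
  branchLayer-inject₁ 1≮aₘ rewrite dec-false (1 <? a (fromℕ (suc m))) 1≮aₘ = refl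

branchLayer-least : ∀ {m s} (a : Fin (suc m) → ℕ) →
                    (∀ i → s < toℕ i → a i ≤ 1) → toℕ (branchLayer a) ≤ s
branchLayer-least {0} _ _ = z≤n
branchLayer-least {suc m} {s} a flat with 1 <? a (fromℕ (suc m))
... | yes 1<aₘ rewrite branchLayer-last a 1<aₘ | toℕ-fromℕ (suc m) =
  ≮⇒≥ λ s<m → <⇒≱ 1<aₘ (flat (fromℕ (suc m)) (subst (s <_) (sym (toℕ-fromℕ (suc m))) s<m))
... | no 1≮aₘ rewrite branchLayer-inject₁ a 1≮aₘ | toℕ-inject₁ (branchLayer (a ∘ inject₁)) =
  branchLayer-least (a ∘ inject₁) λ i s<i → flat (inject₁ i) (subst (s <_) (sym (toℕ-inject₁ i)) s<i)

1<⇒≤branchLayer : ∀ {m} (a : Fin (suc m) → ℕ) i → 1 < a i → toℕ i ≤ toℕ (branchLayer a)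
1<⇒≤branchLayer {0} _ zero _ = z≤n
1<⇒≤branchLayer {suc m} a i 1<aᵢ with 1 <? a (fromℕ (suc m))
... | yes 1<aₘ rewrite branchLayer-last a 1<aₘ | toℕ-fromℕ (suc m) = toℕ≤pred[n] i
... | no 1≮aₘ rewrite branchLayer-inject₁ a 1≮aₘ | toℕ-inject₁ (branchLayer (a ∘ inject₁))
              with view i
...   | ‵fromℕ     = contradiction 1<aᵢ 1≮aₘ
...   | ‵inject₁ j rewrite toℕ-inject₁ j = 1<⇒≤branchLayer (a ∘ inject₁) j 1<aᵢ

branchLayer-cong : ∀ {m} {a b : Fin (suc m) → ℕ} →
                   (∀ i → a i ≡ b i) → branchLayer a ≡ branchLayer b
branchLayer-cong {0} _   = refl
branchLayer-cong {suc m} a≗b rewrite a≗b (fromℕ (suc m)) | branchLayer-cong {m} (a≗b ∘ inject₁) = refl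

module _ {m} (k : Fin (suc m)) (a b : Fin (suc m) → ℕ) (i : Fin (suc m)) where

  combination-≤ : toℕ i ≤ toℕ k → combination k a b i ≡ a i + b i
  combination-≤ i≤k rewrite dec-true (toℕ i ≤? toℕ k) i≤k = refl

  combination-> : ¬ toℕ i ≤ toℕ k → combination k a b i ≡ 1
  combination-> i≰k rewrite dec-false (toℕ i ≤? toℕ k) i≰k = refl

countAt : ∀ {h} → LTree h → Fin (suc h) → ℕ
countAt t i = count i t

module _ {h} {t : LTree h} (f : Fork t) where

  length-weightsAt-fork : ∀ {j} → j ≤ forkLayer f →
    length (weightsAt j t) ≡ length (weightsAt j (left f)) + length (weightsAt j (right f))
  length-weightsAt-fork {j} j≤s =
    trans (cong length (weightsAt-fork f j≤s)) (length-++ (weightsAt j (left f)))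

  weightsAt-left⊆ : ∀ {j} → j ≤ forkLayer f → weightsAt j (left f) ⊆ weightsAt j t
  weightsAt-left⊆ {j} j≤s =
    subst (weightsAt j (left f) ⊆_) (sym (weightsAt-fork f j≤s)) (++⁺ʳ (weightsAt j (right f)) ⊆-refl)

  weightsAt-right⊆ : ∀ {j} → j ≤ forkLayer f → weightsAt j (right f) ⊆ weightsAt j t
  weightsAt-right⊆ {j} j≤s =
    subst (weightsAt j (right f) ⊆_) (sym (weightsAt-fork f j≤s)) (++⁺ˡ (weightsAt j (left f)) ⊆-refl)

  treeBranch-fork : toℕ (treeBranch t) ≡ forkLayer f
  treeBranch-fork = ≤-antisym
    (branchLayer-least (countAt t) λ i s<i → ≤-reflexive (pathAbove-fork f s<i (toℕ≤pred[n] i)))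
    (subst (_≤ toℕ (treeBranch t)) (toℕ-fromℕ< s<1+h)
      (1<⇒≤branchLayer (countAt t) (fromℕ< s<1+h) forked))
    where
    s<1+h = m<n⇒m<1+n (forkLayer< f)
    s≤h = <⇒≤ (forkLayer< f)
    forked : 1 < count (fromℕ< s<1+h) t
    forked rewrite toℕ-fromℕ< s<1+h | length-weightsAt-fork ≤-refl =
      +-mono-≤ (weightsAt-nonempty (left f) s≤h) (weightsAt-nonempty (right f) s≤h)

  count-fork-combination : ∀ k → toℕ k ≡ forkLayer f → ∀ i →
    count i t ≡ combination k (countAt (left f)) (countAt (right f)) i
  count-fork-combination k k≡s i with toℕ i ≤? toℕ k
  ... | yes i≤k = trans (length-weightsAt-fork (subst (toℕ i ≤_) k≡s i≤k))
                        (sym (combination-≤ k (countAt (left f)) (countAt (right f)) i i≤k))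
  ... | no i≰k  = trans (pathAbove-fork f (subst (_< toℕ i) k≡s (≰⇒> i≰k)) (toℕ≤pred[n] i))
                        (sym (combination-> k (countAt (left f)) (countAt (right f)) i i≰k))

module Piece (I : Instance) (T X : LTree (lam I)) {s : ℕ}
            (valid : AlmostValid I T) (branch≡s : toℕ (treeBranch T) ≡ s)
            (sublayer : ∀ {j} → j ≤ s → weightsAt j X ⊆ weightsAt j T)
            (path : PathAbove s X) where

  branch≤ : toℕ (treeBranch X) ≤ s
  branch≤ = branchLayer-least (countAt X) λ i s<i → ≤-reflexive (path s<i (toℕ≤pred[n] i))

  weightsAt-bounded : ∀ i → 1 ≤ toℕ i → toℕ i ≤ s →
    All (λ w → L I i ≤ w × w ≤ U I i) (weightsAt (toℕ i) X)
  weightsAt-bounded i 1≤i i≤s =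
    All-resp-⊆ (sublayer i≤s) (proj₁ (proj₂ valid) i 1≤i (subst (toℕ i ≤_) (sym branch≡s) i≤s))

  count≤n : ∀ i → count i X ≤ n I i
  count≤n i with toℕ i ≤? s
  ... | yes i≤s = ≤-trans (length-mono-≤ (sublayer i≤s)) (proj₁ valid i)
  ... | no i≰s  = ≤-trans (≤-reflexive (path (≰⇒> i≰s) (toℕ≤pred[n] i)))
                          (≤-trans (weightsAt-nonempty T (toℕ≤pred[n] i)) (proj₁ valid i))

  leaves≤leaves : leaves X ≤ leaves T
  leaves≤leaves =
    subst₂ _≤_ (length-weightsAt-zero X) (length-weightsAt-zero T) (length-mono-≤ (sublayer z≤n))

  leaves≤U : ∀ i → toℕ (treeBranch X) < toℕ i → leaves X ≤ U I i
  leaves≤U i b<i with toℕ i ≤? s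
  ... | yes i≤s = proj₂ (All.head (subst (All _) (weightsAt-single X (toℕ≤pred[n] i) single)
                                         (weightsAt-bounded i (≤-trans (s≤s z≤n) b<i) i≤s)))
    where
    single : count i X ≡ 1
    single = ≤-antisym (≮⇒≥ λ 1<xᵢ → <⇒≱ b<i (1<⇒≤branchLayer (countAt X) i 1<xᵢ))
                       (weightsAt-nonempty X (toℕ≤pred[n] i))
  ... | no i≰s  =
    ≤-trans leaves≤leaves (proj₂ (proj₂ valid) i (subst (_< toℕ i) (sym branch≡s) (≰⇒> i≰s)))

  almostValid : AlmostValid I X
  almostValid = count≤n , (λ i 1≤i i≤b → weightsAt-bounded i 1≤i (≤-trans i≤b branch≤)) , leaves≤U

  L≤count₀ : ∀ k → toℕ k ≡ s → L I k ≤ count zero X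
  L≤count₀ zero    _    = weightsAt-nonempty X z≤n
  L≤count₀ (fsuc k) k≡s  = subst (L I (fsuc k) ≤_) (sym (length-weightsAt-zero X))
    (≤-leaves X (toℕ≤pred[n] (fsuc k))
      (All.map proj₁ (weightsAt-bounded (fsuc k) (s≤s z≤n) (≤-reflexive k≡s))))

lemma3p5 : (I : Instance) → Normalized I →
    (c : Fin (suc (lam I)) → ℕ) → RelaxedPartialSolution I c → 2 < c zero →
    Σ (Fin (suc (lam I)) → ℕ) λ a → Σ (Fin (suc (lam I)) → ℕ) λ b →
      RelaxedPartialSolution I a × RelaxedPartialSolution I b ×
      a zero < c zero × b zero < c zero ×
      L I (branchLayer c) ≤ a zero × L I (branchLayer c) ≤ b zero ×
      IsCombination (branchLayer c) a b c
lemma3p5 I _ c (T , valid , T≗c) 2<c₀ with fork? T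
... | inj₂ one-leaf = contradiction (subst (2 <_) c₀≡1 2<c₀) λ { (s≤s ()) }
  where
  c₀≡1 : c zero ≡ 1
  c₀≡1 = trans (sym (T≗c zero)) (trans (length-weightsAt-zero T) one-leaf)
... | inj₁ f =
  countAt A , countAt B , (A , A.almostValid , λ _ → refl) , (B , B.almostValid , λ _ → refl) ,
  subst (count zero A <_) (sym c₀≡) (m<m+n _ (weightsAt-nonempty B z≤n)) ,
  subst (count zero B <_) (sym c₀≡) (m<n+m _ (weightsAt-nonempty A z≤n)) ,
  A.L≤count₀ k k≡s , B.L≤count₀ k k≡s ,
  subst (toℕ (treeBranch A) ≤_) (sym k≡s) A.branch≤ ,
  subst (toℕ (treeBranch B) ≤_) (sym k≡s) B.branch≤ ,
  c≗combination
  where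
  A = left f
  B = right f
  k = branchLayer c
  k≡s : toℕ k ≡ forkLayer f
  k≡s = trans (cong toℕ (branchLayer-cong (sym ∘ T≗c))) (treeBranch-fork f)
  c≗combination : ∀ i → c i ≡ combination k (countAt A) (countAt B) i
  c≗combination i = trans (sym (T≗c i)) (count-fork-combination f k k≡s i)
  c₀≡ : c zero ≡ count zero A + count zero B
  c₀≡ = trans (c≗combination zero) (combination-≤ k (countAt A) (countAt B) zero z≤n)
  module A = Piece I T A valid (treeBranch-fork f) (weightsAt-left⊆ f) (pathAbove-left f)
  module B = Piece I T B valid (treeBranch-fork f) (weightsAt-right⊆ f) (pathAbove-right f)
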